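{- Let $n\ge1$, $d<n$, and let $F:\{0,1\}^n\to\{0,1\}^n$ be a centralized bijection of degree at most $d$, and let $C$ be a Hamiltonian cycle of its interaction graph $G(F)$. Then $w(F,C)$ is even.
   Context: Local functions: $f_j(x)=F(x)_j$. The interaction graph $G(F)$ on $V=\{1,\dots,n\}$ has an arc $(i,j)$ iff $f_j$ effectively depends on $x_i$ (there exist $x,x'$ differing only at $i$ with $f_j(x)\neq f_j(x')$); the degree of $F$ is the maximum in-degree of $G(F)$. $F$ is centralized if $G(F)$ has a node whose deletion leaves the graph acyclic. For a Hamiltonian cycle $C$ of $G(F)$ and $i\in V$, let $j$ be the in-neighbor of $i$ on $C$; $w_i(F,C)$ is the number of $x\in\{0,1\}^n$ with $x_j<f_i(x)$, and $w(F,C)=\sum_{i=1}^n w_i(F,C)$. -}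

module Defs where

open import Data.Bool using (Bool; true; false; not; _∧_; _∨_; if_then_else_)
open import Data.Nat using (ℕ; zero; suc; _+_; _≤_; _%_)
open import Data.Nat.DivMod using (m%n<n)
open import Data.Fin using (Fin; toℕ; fromℕ<; _≟_)
open import Data.Vec using (Vec; []; _∷_; lookup; updateAt)
open import Data.List as List using (List; [_]; concatMap; filterᵇ; length; map; foldr)
open import Data.Bool.ListAction using (any)
open import Data.Product using (Σ; ∃; _×_; _,_)
open import Relation.Binary.PropositionalEquality using (_≡_; _≢_)
open import Relation.Nullary.Decidable using (⌊_⌋)
open import Data.Fin.Permutation using (Permutation′; _⟨$⟩ʳ_; _⟨$⟩ˡ_)

-- Configurations x ∈ {0,1}^n, with 0 = false, 1 = true.
Config : ℕ → Set
Config n = Vec Bool n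

BNet : ℕ → Set
BNet n = Config n → Config n

loc : ∀ {n} → BNet n → Fin n → Config n → Bool
loc F j x = lookup (F x) j

-- explicit enumeration of all of {0,1}^n (each config exactly once)
allConfigs : (n : ℕ) → List (Config n)
allConfigs zero = [ [] ]
allConfigs (suc n) = concatMap (λ v → (false ∷ v) List.∷ (true ∷ v) List.∷ List.[]) (allConfigs n)

flipAt : ∀ {n} → Config n → Fin n → Config n
flipAt x i = updateAt x i not

xorB : Bool → Bool → Bool
xorB a b = if a then not b else b

-- arc (i , j) of G(F): f_j effectively depends on x_i, i.e. there exist
-- x, x' differing only at i with f_j(x) ≠ f_j(x').  (Decided by enumeration.)
arc : ∀ {n} → BNet n → Fin n → Fin n → Bool
arc {n} F i j = any (λ x → xorB (loc F j x) (loc F j (flipAt x i))) (allConfigs n)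

Arc : ∀ {n} → BNet n → Fin n → Fin n → Set
Arc F i j = arc F i j ≡ true

finList : (n : ℕ) → List (Fin n)
finList n = List.allFin n

inDegree : ∀ {n} → BNet n → Fin n → ℕ
inDegree {n} F j = length (filterᵇ (λ i → arc F i j) (finList n))

DegreeAtMost : ∀ {n} → BNet n → ℕ → Set
DegreeAtMost {n} F d = ∀ (j : Fin n) → inDegree F j ≤ d

-- G(F) − v is acyclic: there is no directed cycle (closed walk of positive
-- length k+1, vertices c 0, …, c k, arcs c t → c (t+1) and c k → c 0)
-- all of whose vertices differ from v.
nextMod : ∀ {m} → Fin (suc m) → Fin (suc m)
nextMod {m} k = fromℕ< (m%n<n (suc (toℕ k)) (suc m))

prevMod : ∀ {m} → Fin (suc m) → Fin (suc m)
prevMod {m} k = fromℕ< (m%n<n (toℕ k + m) (suc m))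

AcyclicWithout : ∀ {n} → BNet n → Fin n → Set
AcyclicWithout {n} F v =
  ∀ (k : ℕ) (c : Fin (suc k) → Fin n) →
    (∀ t → c t ≢ v) → (∀ t → Arc F (c t) (c (nextMod t))) → Data.Empty.⊥
  where import Data.Empty

Centralized : ∀ {n} → BNet n → Set
Centralized {n} F = ∃ λ (v : Fin n) → AcyclicWithout F v

-- A Hamiltonian cycle of G(F) (n = suc m ≥ 1): an enumeration σ of all
-- vertices, σ 0, σ 1, …, σ m, with arcs σ t → σ (t+1 mod n).
HamCycle : ∀ {m} → BNet (suc m) → Set
HamCycle {m} F =
  Σ (Permutation′ (suc m)) λ σ → ∀ (t : Fin (suc m)) → Arc F (σ ⟨$⟩ʳ t) (σ ⟨$⟩ʳ nextMod t)

cyclePred : ∀ {m} {F : BNet (suc m)} → HamCycle F → Fin (suc m) → Fin (suc m)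
cyclePred (σ , _) i = σ ⟨$⟩ʳ prevMod (σ ⟨$⟩ˡ i)

-- w_i(F,C) = #{ x : x_j < f_i(x) }, j the in-neighbour of i on C
wᵢ : ∀ {m} (F : BNet (suc m)) → HamCycle F → Fin (suc m) → ℕ
wᵢ {m} F C i =
  length (filterᵇ (λ x → not (lookup x (cyclePred {F = F} C i)) ∧ loc F i x)
                  (allConfigs (suc m)))

w : ∀ {m} (F : BNet (suc m)) → HamCycle F → ℕ
w {m} F C = foldr _+_ 0 (map (wᵢ F C) (finList (suc m)))

-- Every single term w_i(F,C) is already even. The in-neighbour j of i on C is a
-- regulator of f_i, and since i has in-degree at most d < n some coordinate k is
-- not; then k ≠ j, and flipping x_k is a fixed-point-free involution of {0,1}^n
-- that preserves both x_j and f_i(x), so it pairs off the configurations counted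
-- by w_i.
module Submission where

open import Defs
open import Data.Nat using (ℕ; suc; _<_; _+_; _%_)
open import Data.Nat.Divisibility using (_∣_)
open import Function.Definitions using (Bijective)
open import Relation.Binary.PropositionalEquality using (_≡_)

open import Data.Bool using (Bool; true; false; not; _∧_)
open import Data.Bool.ListAction using (any)
open import Data.Fin using (Fin; toℕ; zero; suc)
open import Data.Fin.Permutation using (_⟨$⟩ʳ_; _⟨$⟩ˡ_; inverseʳ)
open import Data.Fin.Properties using (toℕ-injective; toℕ-fromℕ<; toℕ<n)
open import Data.List using (List; []; _∷_; filterᵇ; length; concatMap; map)
open import Data.List.Membership.Propositional using (_∈_; lose)
open import Data.List.Membership.Propositional.Properties using (∈-concatMap⁺)
open import Data.List.Properties using (length-tabulate)
open import Data.List.Relation.Unary.Any using (here; there)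
open import Data.Nat.DivMod using (%-distribˡ-+; m%n%n≡m%n; [m+n]%n≡m%n; m<n⇒m%n≡m)
open import Data.Nat.Divisibility using (∣m∣n⇒∣m+n; m∣m*n; _∣0)
open import Data.Nat.ListAction using (sum)
open import Data.Nat.Properties using (+-suc; +-identityʳ; ≤-pred; ≤-<-trans)
open import Data.Nat.Tactic.RingSolver using (solve-∀)
open import Data.Product using (∃; _,_)
open import Data.Vec using ([]; _∷_)
open import Data.Vec.Properties using (lookup∘updateAt′)
open import Function using (_∘_)
open import Relation.Binary.PropositionalEquality
  using (_≢_; refl; sym; trans; cong; cong₂; subst; module ≡-Reasoning)

open ≡-Reasoning

count : ∀ {A : Set} → (A → Bool) → List A → ℕ
count p xs = length (filterᵇ p xs)

toℕᵇ : Bool → ℕ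
toℕᵇ false = 0
toℕᵇ true  = 1

count-∷ : ∀ {A : Set} (p : A → Bool) x xs → count p (x ∷ xs) ≡ toℕᵇ (p x) + count p xs
count-∷ p x xs with p x
... | true  = refl
... | false = refl

count-cong : ∀ {A : Set} {p q : A → Bool} → (∀ x → p x ≡ q x) → ∀ xs → count p xs ≡ count q xs
count-cong p≗q []       = refl
count-cong {p = p} {q} p≗q (x ∷ xs) = begin
  count p (x ∷ xs)             ≡⟨ count-∷ p x xs ⟩
  toℕᵇ (p x) + count p xs      ≡⟨ cong₂ _+_ (cong toℕᵇ (p≗q x)) (count-cong p≗q xs) ⟩
  toℕᵇ (q x) + count q xs      ≡⟨ count-∷ q x xs ⟨
  count q (x ∷ xs)             ∎

extensions : ∀ {n} → Config n → List (Config (suc n))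
extensions v = (false ∷ v) ∷ (true ∷ v) ∷ []

count-concatMap-extensions : ∀ {n} (p : Config (suc n) → Bool) (vs : List (Config n)) →
  count p (concatMap extensions vs) ≡ count (p ∘ (false ∷_)) vs + count (p ∘ (true ∷_)) vs
count-concatMap-extensions p []       = refl
count-concatMap-extensions p (v ∷ vs) = begin
  count p (concatMap extensions (v ∷ vs))
    ≡⟨ count-∷ p (false ∷ v) _ ⟩
  a + count p ((true ∷ v) ∷ concatMap extensions vs)
    ≡⟨ cong (a +_) (count-∷ p (true ∷ v) _) ⟩
  a + (b + count p (concatMap extensions vs))
    ≡⟨ cong (λ c → a + (b + c)) (count-concatMap-extensions p vs) ⟩
  a + (b + (count (p ∘ (false ∷_)) vs + count (p ∘ (true ∷_)) vs))
    ≡⟨ interchange a b _ _ ⟩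
  (a + count (p ∘ (false ∷_)) vs) + (b + count (p ∘ (true ∷_)) vs)
    ≡⟨ cong₂ _+_ (count-∷ (p ∘ (false ∷_)) v vs) (count-∷ (p ∘ (true ∷_)) v vs) ⟨
  count (p ∘ (false ∷_)) (v ∷ vs) + count (p ∘ (true ∷_)) (v ∷ vs) ∎
  where
  a = toℕᵇ (p (false ∷ v))
  b = toℕᵇ (p (true ∷ v))
  interchange : ∀ a b c d → a + (b + (c + d)) ≡ (a + c) + (b + d)
  interchange = solve-∀

∈-allConfigs : ∀ {n} (x : Config n) → x ∈ allConfigs n
∈-allConfigs []      = here refl
∈-allConfigs (b ∷ v) = ∈-concatMap⁺ extensions (lose (∈-allConfigs v) (∈-extensions b))
  where
  ∈-extensions : ∀ b → (b ∷ v) ∈ extensions v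
  ∈-extensions false = here refl
  ∈-extensions true  = there (here refl)

2∣m+m : ∀ m → 2 ∣ m + m
2∣m+m m = subst (2 ∣_) (cong (m +_) (+-identityʳ m)) (m∣m*n m)

flipAt-invariant⇒even-count : ∀ {n} (k : Fin n) (p : Config n → Bool) →
  (∀ x → p (flipAt x k) ≡ p x) → 2 ∣ count p (allConfigs n)
flipAt-invariant⇒even-count {suc n} zero p inv =
  subst (2 ∣_) (sym count≡a+a) (2∣m+m a)
  where
  a = count (p ∘ (false ∷_)) (allConfigs n)
  count≡a+a : count p (allConfigs (suc n)) ≡ a + a
  count≡a+a = trans (count-concatMap-extensions p (allConfigs n))
                    (cong (a +_) (count-cong {q = p ∘ (false ∷_)} (λ v → inv (false ∷ v)) (allConfigs n)))
flipAt-invariant⇒even-count {suc n} (suc k) p inv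
  rewrite count-concatMap-extensions p (allConfigs n) =
  ∣m∣n⇒∣m+n (flipAt-invariant⇒even-count k _ (λ v → inv (false ∷ v)))
            (flipAt-invariant⇒even-count k _ (λ v → inv (true ∷ v)))

count<length⇒∃false : ∀ {A : Set} (p : A → Bool) xs → count p xs < length xs → ∃ λ x → p x ≡ false
count<length⇒∃false p (x ∷ xs) lt with p x in px
... | false = x , px
... | true  = count<length⇒∃false p xs (≤-pred lt)

any≡false⇒≡false : ∀ {A : Set} (p : A → Bool) {xs x} → any p xs ≡ false → x ∈ xs → p x ≡ false
any≡false⇒≡false p {y ∷ _} noneTrue (here refl) with p y | noneTrue
... | false | _ = refl
any≡false⇒≡false p {y ∷ _} noneTrue (there x∈xs) with p y | noneTrue
... | false | noneTrueRest = any≡false⇒≡false p noneTrueRest x∈xs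

xorB≡false⇒≡ : ∀ a b → xorB a b ≡ false → a ≡ b
xorB≡false⇒≡ false false _ = refl
xorB≡false⇒≡ true  true  _ = refl

¬arc⇒flipAt-invariant : ∀ {n} (F : BNet n) {k i} → arc F k i ≡ false →
  ∀ x → loc F i (flipAt x k) ≡ loc F i x
¬arc⇒flipAt-invariant F ¬k→i x =
  sym (xorB≡false⇒≡ _ _ (any≡false⇒≡false _ ¬k→i (∈-allConfigs x)))

inDegree<n⇒∃¬arc : ∀ {n} (F : BNet n) i → inDegree F i < n → ∃ λ k → arc F k i ≡ false
inDegree<n⇒∃¬arc {n} F i lt =
  count<length⇒∃false (λ k → arc F k i) (finList n)
    (subst (inDegree F i <_) (sym (length-tabulate {n = n} (λ k → k))) lt)

1+[m%n]%n≡[1+m]%n : ∀ m n → suc (m % suc n) % suc n ≡ suc m % suc n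
1+[m%n]%n≡[1+m]%n m n = begin
  (1 + m % N) % N           ≡⟨ %-distribˡ-+ 1 (m % N) N ⟩
  (1 % N + m % N % N) % N   ≡⟨ cong (λ r → (1 % N + r) % N) (m%n%n≡m%n m N) ⟩
  (1 % N + m % N) % N       ≡⟨ %-distribˡ-+ 1 m N ⟨
  (1 + m) % N               ∎
  where N = suc n

nextMod∘prevMod : ∀ {m} (s : Fin (suc m)) → nextMod (prevMod s) ≡ s
nextMod∘prevMod {m} s = toℕ-injective (begin
  toℕ (nextMod (prevMod s))        ≡⟨ toℕ-fromℕ< _ ⟩
  suc (toℕ (prevMod s)) % suc m    ≡⟨ cong (λ r → suc r % suc m) (toℕ-fromℕ< _) ⟩
  suc (x % suc m) % suc m          ≡⟨ 1+[m%n]%n≡[1+m]%n x m ⟩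
  suc x % suc m                    ≡⟨ cong (_% suc m) (+-suc (toℕ s) m) ⟨
  (toℕ s + suc m) % suc m          ≡⟨ [m+n]%n≡m%n (toℕ s) (suc m) ⟩
  toℕ s % suc m                    ≡⟨ m<n⇒m%n≡m (toℕ<n s) ⟩
  toℕ s                            ∎)
  where x = toℕ s + m

cyclePred-arc : ∀ {m} {F : BNet (suc m)} (C : HamCycle F) i → Arc F (cyclePred {F = F} C i) i
cyclePred-arc {F = F} (σ , ham) i =
  subst (Arc F (σ ⟨$⟩ʳ t))
        (trans (cong (σ ⟨$⟩ʳ_) (nextMod∘prevMod (σ ⟨$⟩ˡ i))) (inverseʳ σ))
        (ham t)
  where t = prevMod (σ ⟨$⟩ˡ i)

wᵢ-even : ∀ {m} (F : BNet (suc m)) → (∀ i → inDegree F i < suc m) →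
  (C : HamCycle F) → ∀ i → 2 ∣ wᵢ F C i
wᵢ-even F inDegree<n C i with inDegree<n⇒∃¬arc F i (inDegree<n i)
... | k , ¬k→i = flipAt-invariant⇒even-count k _ λ x →
  cong₂ (λ xⱼ fᵢ → not xⱼ ∧ fᵢ) (lookup∘updateAt′ j k j≢k x) (¬arc⇒flipAt-invariant F ¬k→i x)
  where
  j = cyclePred {F = F} C i
  j≢k : j ≢ k
  j≢k j≡k with trans (sym (cyclePred-arc {F = F} C i)) (trans (cong (λ v → arc F v i) j≡k) ¬k→i)
  ... | ()

∣-sum-map : ∀ {A : Set} {d} (f : A → ℕ) → (∀ x → d ∣ f x) → ∀ xs → d ∣ sum (map f xs)
∣-sum-map f d∣f []       = _ ∣0
∣-sum-map f d∣f (x ∷ xs) = ∣m∣n⇒∣m+n (d∣f x) (∣-sum-map f d∣f xs)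

lemma10 : ∀ (m d : ℕ) → d < suc m → (F : BNet (suc m)) →
    Bijective _≡_ _≡_ F → Centralized F → DegreeAtMost F d →
    (C : HamCycle F) → 2 ∣ w F C
lemma10 m d d<n F _ _ degree≤d C =
  ∣-sum-map (wᵢ F C) (wᵢ-even F (λ i → ≤-<-trans (degree≤d i) d<n) C) (finList (suc m))
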